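{- Let $n\geq 8$ and let $T$ be a tree with $n$ vertices that has a pendant star $K_{1,d}$ with $d\geq4$. Then $\Psi(T)$ is not minimum over all trees with $n$ vertices, i.e. there is a tree $T'$ with $n$ vertices with $\Psi(T')<\Psi(T)$.
   Context: A matching of a graph is a set of edges no two of which share a vertex; it is maximal if it is not properly contained in another matching. $\Psi(G)$ denotes the number of maximal matchings of $G$. For a connected graph $G$ not isomorphic to a star $K_{1,t}$, a pendant star with $t$ rays ($t\ge3$) in $G$ is a subgraph isomorphic to $K_{1,t}$ such that $t-1$ of its leaves are leaves (degree-$1$ vertices) of $G$ and its central vertex has degree $t$ in $G$. -}

module Defs where

open import Data.Nat using (ℕ; zero; suc; _+_; _≤_; _<_; _∸_)
open import Data.Fin using (Fin)
open import Data.Bool using (Bool; true; false; if_then_else_)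
open import Data.List using (List; []; _∷_; _++_; [_]; length; map; allFin)
open import Data.Nat.ListAction using (sum)
open import Data.Unit using (⊤)
open import Data.List.Relation.Unary.All using (All)
open import Data.List.Relation.Unary.Unique.Propositional using (Unique)
open import Data.Vec using (Vec; lookup)
open import Data.Product using (Σ; _×_; ∃)
open import Data.Sum using (_⊎_)
open import Relation.Binary.PropositionalEquality using (_≡_)
open import Relation.Nullary using (¬_)

record Graph (n : ℕ) : Set where
  field
    adj    : Fin n → Fin n → Bool
    sym    : ∀ i j → adj i j ≡ adj j i
    irrefl : ∀ i → adj i i ≡ false
open Graph public

module _ {n : ℕ} (G : Graph n) where

  data Walk : Fin n → Fin n → Set where
    here : ∀ {u} → Walk u u
    step : ∀ {u w v} → adj G u w ≡ true → Walk w v → Walk u v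

  Connected : Set
  Connected = ∀ u v → Walk u v

  Chain : List (Fin n) → Set
  Chain []           = ⊤
  Chain (x ∷ [])     = ⊤
  Chain (x ∷ y ∷ xs) = (adj G x y ≡ true) × Chain (y ∷ xs)

  Cycle : Set
  Cycle = Σ (Fin n) λ u → Σ (List (Fin n)) λ xs →
            (2 ≤ length xs) × Unique (u ∷ xs) × Chain (u ∷ xs ++ [ u ])

  Acyclic : Set
  Acyclic = ¬ Cycle

  degree : Fin n → ℕ
  degree v = sum (map (λ j → if adj G v j then 1 else 0) (allFin n))

  IsStar : Set
  IsStar = Σ (Fin n) λ c → ∀ i j → adj G i j ≡ true → (i ≡ c) ⊎ (j ≡ c)

  -- pendant star with t rays: central vertex c of degree t in G, and t-1
  -- distinct neighbours of c that are leaves of G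
  HasPendantStar : ℕ → Set
  HasPendantStar t = Σ (Fin n) λ c → (degree c ≡ t) ×
     Σ (List (Fin n)) λ ls → (length ls ≡ t ∸ 1) × Unique ls ×
       All (λ l → (adj G c l ≡ true) × (degree l ≡ 1)) ls

  -- an edge subset, encoded as a symmetric 0/1 matrix
  EdgeSet : Set
  EdgeSet = Vec (Vec Bool n) n

  _∋_ : EdgeSet → Fin n → Fin n → Set
  (M ∋ i) j = lookup (lookup M i) j ≡ true

  IsMatching : EdgeSet → Set
  IsMatching M = (∀ i j → (M ∋ i) j → adj G i j ≡ true)
               × (∀ i j → (M ∋ i) j → (M ∋ j) i)
               × (∀ i j k → (M ∋ i) j → (M ∋ i) k → j ≡ k)

  _⊆E_ : EdgeSet → EdgeSet → Set
  M ⊆E M' = ∀ i j → (M ∋ i) j → (M' ∋ i) j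

  IsMaximalMatching : EdgeSet → Set
  IsMaximalMatching M = IsMatching M × (∀ M' → IsMatching M' → M ⊆E M' → M' ≡ M)

  -- Ψ(G) = k : the maximal matchings of G are enumerated without repetition by Fin k
  Ψ≡ : ℕ → Set
  Ψ≡ k = Σ (Fin k → EdgeSet) λ f →
           (∀ a b → f a ≡ f b → a ≡ b)
         × (∀ a → IsMaximalMatching (f a))
         × (∀ M → IsMaximalMatching M → ∃ λ a → f a ≡ M)

IsTree : ∀ {n} → Graph n → Set
IsTree G = Connected G × Acyclic G

-- Let c carry three leaves l₁, l₂, l₃ and let T' be T with l₁ moved from c to l₂; T' is again a
-- tree. Deleting l₁ from a maximal matching of T' gives a maximal matching of T avoiding c l₁
-- (the leaf l₃ keeps c matched), and conversely a maximal matching of T avoiding c l₁ becomes one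
-- of T' by adding l₁ l₂ exactly when l₂ is unmatched. Hence Ψ(T') counts the maximal matchings of
-- T avoiding c l₁, and any maximal matching through c l₁ makes Ψ(T') < Ψ(T). Only three leaves at
-- c are used.

module Submission where

open import Defs hiding (sym)
open import Defs using () renaming (sym to adj-sym)
open import Data.Bool as Bool using (Bool; true; false; if_then_else_; _∧_; _∨_; not)
open import Data.Bool.Properties using (not-¬; not-injective; ∨-zeroʳ)
open import Data.Empty using (⊥-elim)
open import Data.Fin using (Fin; zero; suc; punchOut)
open import Data.Fin.Properties using (_≟_; any?; suc-injective; punchOut-injective; injective⇒≤)
open import Data.Nat using (ℕ; zero; suc; pred; _+_; _≤_; _<_; s≤s)
open import Data.Nat.ListAction using (sum)
open import Data.Nat.Properties using (≤-trans; ≤-reflexive; m≤m+n; m≤n+m; +-monoʳ-≤; +-comm)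
open import Data.List
  using (List; []; _∷_; [_]; _++_; length; map; foldl; allFin; cartesianProduct; initLast; _∷ʳ′_)
open import Data.List.Properties using (++-assoc)
open import Data.List.Relation.Binary.Permutation.Propositional using (_↭_; ↭⇒↭ₛ)
open import Data.List.Relation.Binary.Permutation.Propositional.Properties
  using (↭-length) renaming (++-comm to ↭-++-comm)
open import Data.List.Relation.Binary.Permutation.Setoid.Properties using (Unique-resp-↭)
open import Data.List.Relation.Unary.Unique.Propositional using (Unique)
open import Data.List.Membership.Propositional using (_∈_; _∉_)
open import Data.List.Membership.Propositional.Properties
  using (∈-allFin; ∈-cartesianProduct⁺; ∈-∃++; ∈-++⁺ʳ)
open import Data.List.Relation.Unary.All as All using (All; []; _∷_)
open import Data.List.Relation.Unary.All.Properties using (¬Any⇒All¬; ++⁺)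
open import Data.List.Relation.Unary.AllPairs as AllPairs using ([]; _∷_)
open import Data.List.Relation.Unary.Any using (here; there)
open import Data.Product using (Σ; _×_; ∃; _,_; proj₁; proj₂)
open import Data.Sum using (_⊎_; inj₁; inj₂; swap)
open import Data.Unit using (tt)
open import Data.Vec using (Vec; lookup; tabulate)
open import Data.Vec.Properties using (lookup∘tabulate; tabulate∘lookup; tabulate-cong)
open import Relation.Binary.PropositionalEquality hiding ([_])
open import Function using (_∘_)
open import Function.Definitions using (Injective)
open import Relation.Nullary using (¬_; Dec; yes; no; does)
open import Relation.Nullary.Decidable using (dec-true; dec-false)

-- Boolean relations and matrices on Fin n

_==_ : ∀ {n} → Fin n → Fin n → Bool
i == j = does (i ≟ j)

==-refl : ∀ {n} (i : Fin n) → i == i ≡ true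
==-refl i = dec-true (i ≟ i) refl

==-≢ : ∀ {n} {i j : Fin n} → i ≢ j → i == j ≡ false
==-≢ {i = i} {j} = dec-false (i ≟ j)

==⇒≡ : ∀ {n} {i j : Fin n} → i == j ≡ true → i ≡ j
==⇒≡ {i = i} {j} e with i ≟ j
... | yes i≡j = i≡j

≡-from-true⇔true : ∀ {a b : Bool} → (a ≡ true → b ≡ true) → (b ≡ true → a ≡ true) → a ≡ b
≡-from-true⇔true {false} {false} _ _ = refl
≡-from-true⇔true {false} {true}  _ b⇒a = b⇒a refl
≡-from-true⇔true {true}  {false} a⇒b _ = sym (a⇒b refl)
≡-from-true⇔true {true}  {true}  _ _ = refl

true-or-false : ∀ b → b ≡ true ⊎ b ≡ false
true-or-false true  = inj₁ refl
true-or-false false = inj₂ refl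

∨-true⁻ : ∀ x {y} → x ∨ y ≡ true → x ≡ true ⊎ y ≡ true
∨-true⁻ true  _ = inj₁ refl
∨-true⁻ false e = inj₂ e

∧-true⁻ : ∀ x {y} → x ∧ y ≡ true → x ≡ true × y ≡ true
∧-true⁻ true e = refl , e

BoolMatrix : ℕ → Set
BoolMatrix n = Vec (Vec Bool n) n

SymmetricRel : ∀ {n} → (Fin n → Fin n → Bool) → Set
SymmetricRel f = ∀ i j → f i j ≡ true → f j i ≡ true

FunctionalRel : ∀ {n} → (Fin n → Fin n → Bool) → Set
FunctionalRel f = ∀ i j k → f i j ≡ true → f i k ≡ true → j ≡ k

entry : ∀ {n} → BoolMatrix n → Fin n → Fin n → Bool
entry M i j = lookup (lookup M i) j

tabulate₂ : ∀ {n} → (Fin n → Fin n → Bool) → BoolMatrix n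
tabulate₂ f = tabulate (λ i → tabulate (f i))

entry-tabulate₂ : ∀ {n} (f : Fin n → Fin n → Bool) i j → entry (tabulate₂ f) i j ≡ f i j
entry-tabulate₂ f i j rewrite lookup∘tabulate (λ i → tabulate (f i)) i = lookup∘tabulate (f i) j

entry-injective : ∀ {n} {M N : BoolMatrix n} → (∀ i j → entry M i j ≡ entry N i j) → M ≡ N
entry-injective {M = M} {N} M≗N = begin
  M                                 ≡⟨ sym (tabulate∘lookup M) ⟩
  tabulate (lookup M)               ≡⟨ tabulate-cong (λ i → begin
      lookup M i                    ≡⟨ sym (tabulate∘lookup (lookup M i)) ⟩
      tabulate (entry M i)          ≡⟨ tabulate-cong (M≗N i) ⟩
      tabulate (entry N i)          ≡⟨ tabulate∘lookup (lookup N i) ⟩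
      lookup N i                    ∎) ⟩
  tabulate (lookup N)               ≡⟨ tabulate∘lookup N ⟩
  N                                 ∎
  where open ≡-Reasoning

data Position {n} (l : Fin n) : Fin n → Fin n → Set where
  inRow : ∀ j → Position l l j
  inCol : ∀ {i} → i ≢ l → Position l i l
  off   : ∀ {i j} → i ≢ l → j ≢ l → Position l i j

position : ∀ {n} (l i j : Fin n) → Position l i j
position l i j with i ≟ l | j ≟ l
... | yes refl | _        = inRow j
... | no i≢l   | yes refl = inCol i≢l
... | no i≢l   | no j≢l   = off i≢l j≢l

-- Both row and column l are replaced by r.
setRow : ∀ {n} → Fin n → (Fin n → Bool) → (Fin n → Fin n → Bool) → Fin n → Fin n → Bool
setRow l r f i j = if i == l then r j else if j == l then r i else f i j

module _ {n} (l : Fin n) (r : Fin n → Bool) where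

  setRow-row : ∀ f j → setRow l r f l j ≡ r j
  setRow-row f j rewrite ==-refl l = refl

  setRow-col : ∀ f {i} → i ≢ l → setRow l r f i l ≡ r i
  setRow-col f i≢l rewrite ==-≢ i≢l | ==-refl l = refl

  setRow-off : ∀ f {i j} → i ≢ l → j ≢ l → setRow l r f i j ≡ f i j
  setRow-off f i≢l j≢l rewrite ==-≢ i≢l | ==-≢ j≢l = refl

  setRow-symmetric : ∀ f → SymmetricRel f → SymmetricRel (setRow l r f)
  setRow-symmetric f f-sym i j e with position l i j | position l j i
  ... | inRow _     | inRow _     = e
  ... | inRow _     | inCol j≢l   = trans (setRow-col f j≢l) (trans (sym (setRow-row f j)) e)
  ... | inRow _     | off _ l≢l   = ⊥-elim (l≢l refl)
  ... | inCol i≢l   | _           = trans (setRow-row f i) (trans (sym (setRow-col f i≢l)) e)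
  ... | off i≢l j≢l | _           =
    trans (setRow-off f j≢l i≢l) (f-sym i j (trans (sym (setRow-off f i≢l j≢l)) e))

link : ∀ {n} → Fin n → Fin n → Fin n → Fin n → Bool
link i j a b = (a == i ∧ b == j) ∨ (a == j ∧ b == i)

link-view : ∀ {n} (i j a b : Fin n) → link i j a b ≡ true → (a ≡ i × b ≡ j) ⊎ (a ≡ j × b ≡ i)
link-view i j a b e with a ≟ i | b ≟ j | a ≟ j | b ≟ i
... | yes a≡i | yes b≡j | _       | _       = inj₁ (a≡i , b≡j)
... | _       | _       | yes a≡j | yes b≡i = inj₂ (a≡j , b≡i)
... | no _    | _       | no _    | _       = ⊥-elim (not-¬ e refl)
... | no _    | _       | yes _   | no _    = ⊥-elim (not-¬ e refl)
... | yes _   | no _    | no _    | _       = ⊥-elim (not-¬ e refl)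
... | yes _   | no _    | yes _   | no _    = ⊥-elim (not-¬ e refl)

link-here : ∀ {n} (i j : Fin n) → link i j i j ≡ true
link-here i j rewrite ==-refl i | ==-refl j = refl

link-sym : ∀ {n} (i j a b : Fin n) → link i j a b ≡ true → link i j b a ≡ true
link-sym i j a b e with link-view i j a b e
... | inj₁ (refl , refl) rewrite ==-refl i | ==-refl j = ∨-zeroʳ (b == i ∧ a == j)
... | inj₂ (refl , refl) = link-here i j

link-source : ∀ {n} (i j a b : Fin n) → link i j a b ≡ true → a ≡ i ⊎ a ≡ j
link-source i j a b e with link-view i j a b e
... | inj₁ (a≡i , _) = inj₁ a≡i
... | inj₂ (a≡j , _) = inj₂ a≡j

link-functional : ∀ {n} (i j a b b' : Fin n) → i ≢ j →
                  link i j a b ≡ true → link i j a b' ≡ true → b ≡ b'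
link-functional i j a b b' i≢j e e'
  with link-view i j a b e | link-view i j a b' e'
... | inj₁ (_ , b≡j)     | inj₁ (_ , b'≡j)    = trans b≡j (sym b'≡j)
... | inj₂ (_ , b≡i)     | inj₂ (_ , b'≡i)    = trans b≡i (sym b'≡i)
... | inj₁ (a≡i , _)     | inj₂ (a≡j , _)     = ⊥-elim (i≢j (trans (sym a≡i) a≡j))
... | inj₂ (a≡j , _)     | inj₁ (a≡i , _)     = ⊥-elim (i≢j (trans (sym a≡i) a≡j))

adj⇒≢ : ∀ {n} (G : Graph n) {i j} → adj G i j ≡ true → i ≢ j
adj⇒≢ G {i} e refl = not-¬ e (irrefl G i)

OnlyNeighbour : ∀ {n} → Graph n → Fin n → Fin n → Set
OnlyNeighbour G w v = ∀ x → adj G v x ≡ true → x ≡ w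

module _ {n} (l : Fin n) (r : Fin n → Bool) where

  setRowᴱ : BoolMatrix n → BoolMatrix n
  setRowᴱ M = tabulate₂ (setRow l r (entry M))

  setRowᴱ-row : ∀ M j → entry (setRowᴱ M) l j ≡ r j
  setRowᴱ-row M j = trans (entry-tabulate₂ _ l j) (setRow-row l r (entry M) j)

  setRowᴱ-col : ∀ M {i} → i ≢ l → entry (setRowᴱ M) i l ≡ r i
  setRowᴱ-col M {i} i≢l = trans (entry-tabulate₂ _ i l) (setRow-col l r (entry M) i≢l)

  setRowᴱ-off : ∀ M {i j} → i ≢ l → j ≢ l → entry (setRowᴱ M) i j ≡ entry M i j
  setRowᴱ-off M {i} {j} i≢l j≢l = trans (entry-tabulate₂ _ i j) (setRow-off l r (entry M) i≢l j≢l)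

  setRowᴱ-≡ : ∀ M N → SymmetricRel (entry N) →
              (∀ j → r j ≡ entry N l j) → (∀ {i j} → i ≢ l → j ≢ l → entry M i j ≡ entry N i j) →
              setRowᴱ M ≡ N
  setRowᴱ-≡ M N N-sym row elsewhere = entry-injective λ i j → go i j (position l i j)
    where
    go : ∀ i j → Position l i j → entry (setRowᴱ M) i j ≡ entry N i j
    go _ j (inRow _)         = trans (setRowᴱ-row M j) (row j)
    go i _ (inCol i≢l)       = trans (setRowᴱ-col M i≢l)
                                 (trans (row i) (≡-from-true⇔true (N-sym l i) (N-sym i l)))
    go i j (off i≢l j≢l)     = trans (setRowᴱ-off M i≢l j≢l) (elsewhere i≢l j≢l)

  setRowᴱ-isMatching :
    ∀ (H : Graph n) M →
    SymmetricRel (entry M) → FunctionalRel (entry M) →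
    (∀ {i j} → i ≢ l → j ≢ l → entry M i j ≡ true → adj H i j ≡ true) →
    (∀ x → r x ≡ true → adj H l x ≡ true) →
    (∀ x y → r x ≡ true → r y ≡ true → x ≡ y) →
    (∀ x j → r x ≡ true → entry M x j ≡ true → j ≡ l) →
    IsMatching H (setRowᴱ M)
  setRowᴱ-isMatching H M M-sym M-fun off-edge row-edge row-unique row-free =
    edge , symmetric , functional
    where
    R = setRowᴱ M
    edge : ∀ i j → entry R i j ≡ true → adj H i j ≡ true
    edge i j e with position l i j
    ... | inRow j     = row-edge j (trans (sym (setRowᴱ-row M j)) e)
    ... | inCol i≢l   = trans (adj-sym H i l) (row-edge i (trans (sym (setRowᴱ-col M i≢l)) e))
    ... | off i≢l j≢l = off-edge i≢l j≢l (trans (sym (setRowᴱ-off M i≢l j≢l)) e)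
    symmetric : SymmetricRel (entry R)
    symmetric i j e = trans (entry-tabulate₂ _ j i)
      (setRow-symmetric l r (entry M) M-sym i j (trans (sym (entry-tabulate₂ _ i j)) e))
    functional : FunctionalRel (entry R)
    functional i j k e e' with position l i j | position l i k
    ... | inRow j     | _           = row-unique j k (trans (sym (setRowᴱ-row M j)) e)
                                                     (trans (sym (setRowᴱ-row M k)) e')
    ... | inCol _     | inCol _     = refl
    ... | inCol i≢l   | off _ k≢l   = ⊥-elim (k≢l (row-free i k (trans (sym (setRowᴱ-col M i≢l)) e)
                                                      (trans (sym (setRowᴱ-off M i≢l k≢l)) e')))
    ... | off _ j≢l   | inCol i≢l   = ⊥-elim (j≢l (row-free i j (trans (sym (setRowᴱ-col M i≢l)) e')
                                                      (trans (sym (setRowᴱ-off M i≢l j≢l)) e)))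
    ... | off i≢l j≢l | off _ k≢l   = M-fun i j k (trans (sym (setRowᴱ-off M i≢l j≢l)) e)
                                                   (trans (sym (setRowᴱ-off M i≢l k≢l)) e')
    ... | inCol i≢l   | inRow _     = ⊥-elim (i≢l refl)
    ... | off i≢l _   | inRow _     = ⊥-elim (i≢l refl)

-- Maximal matchings

Matched : ∀ {n} → BoolMatrix n → Fin n → Set
Matched M i = ∃ λ j → entry M i j ≡ true

matched? : ∀ {n} (M : BoolMatrix n) i → Dec (Matched M i)
matched? M i = any? (λ j → entry M i j Bool.≟ true)

module Matching {n} (G : Graph n) where

  _⊆_ : EdgeSet G → EdgeSet G → Set
  _⊆_ = _⊆E_ G

  Matched-mono : ∀ M M' → M ⊆ M' → ∀ {i} → Matched M i → Matched M' i
  Matched-mono M M' M⊆M' (j , Mij) = j , M⊆M' _ j Mij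

  Covering : EdgeSet G → Set
  Covering M = ∀ i j → adj G i j ≡ true → Matched M i ⊎ Matched M j

  covering⇒maximal : ∀ M → IsMatching G M → Covering M → IsMaximalMatching G M
  covering⇒maximal M M-matching@(_ , M-sym , _) cover =
    M-matching , λ M' M'-matching M⊆M' →
      entry-injective λ i j → ≡-from-true⇔true (M'⊆M M' M'-matching M⊆M' i j) (M⊆M' i j)
    where
    M'⊆M : ∀ M' → IsMatching G M' → M ⊆ M' → M' ⊆ M
    M'⊆M M' (M'-edge , M'-sym , M'-fun) M⊆M' i j M'ij with cover i j (M'-edge i j M'ij)
    ... | inj₁ (x , Mix) =
      subst (λ y → entry M i y ≡ true) (M'-fun i x j (M⊆M' i x Mix) M'ij) Mix
    ... | inj₂ (x , Mjx) =
      M-sym j i (subst (λ y → entry M j y ≡ true)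
                       (M'-fun j x i (M⊆M' j x Mjx) (M'-sym i j M'ij)) Mjx)

  insertEdge : EdgeSet G → Fin n → Fin n → EdgeSet G
  insertEdge M i j = tabulate₂ (λ a b → entry M a b ∨ link i j a b)

  ⊆-insertEdge : ∀ M i j → M ⊆ insertEdge M i j
  ⊆-insertEdge M i j a b Mab = trans (entry-tabulate₂ _ a b) (cong (_∨ link i j a b) Mab)

  insertEdge-here : ∀ M i j → entry (insertEdge M i j) i j ≡ true
  insertEdge-here M i j =
    trans (entry-tabulate₂ _ i j) (trans (cong (entry M i j ∨_) (link-here i j)) (∨-zeroʳ _))

  insertEdge-view : ∀ M i j a b → entry (insertEdge M i j) a b ≡ true →
                    entry M a b ≡ true ⊎ link i j a b ≡ true
  insertEdge-view M i j a b e =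
    ∨-true⁻ (entry M a b)
      (trans (sym (entry-tabulate₂ (λ a b → entry M a b ∨ link i j a b) a b)) e)

  link⊆insertEdge : ∀ M i j a b → link i j a b ≡ true → entry (insertEdge M i j) a b ≡ true
  link⊆insertEdge M i j a b e =
    trans (entry-tabulate₂ _ a b) (trans (cong (entry M a b ∨_) e) (∨-zeroʳ _))

  insertEdge-isMatching : ∀ {M} i j → IsMatching G M → adj G i j ≡ true →
                          ¬ Matched M i → ¬ Matched M j → IsMatching G (insertEdge M i j)
  insertEdge-isMatching {M} i j (M-edge , M-sym , M-fun) Gij i-free j-free =
    edge , symmetric , functional
    where
    edge : ∀ a b → entry (insertEdge M i j) a b ≡ true → adj G a b ≡ true
    edge a b e with insertEdge-view M i j a b e
    ... | inj₁ Mab = M-edge a b Mab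
    ... | inj₂ l with link-view i j a b l
    ...   | inj₁ (refl , refl) = Gij
    ...   | inj₂ (refl , refl) = trans (adj-sym G a b) Gij
    symmetric : SymmetricRel (entry (insertEdge M i j))
    symmetric a b e with insertEdge-view M i j a b e
    ... | inj₁ Mab = ⊆-insertEdge M i j b a (M-sym a b Mab)
    ... | inj₂ l   = link⊆insertEdge M i j b a (link-sym i j a b l)
    free : ∀ a b → link i j a b ≡ true → ¬ Matched M a
    free a b l with link-source i j a b l
    ... | inj₁ refl = i-free
    ... | inj₂ refl = j-free
    functional : FunctionalRel (entry (insertEdge M i j))
    functional a b b' e e' with insertEdge-view M i j a b e | insertEdge-view M i j a b' e'
    ... | inj₁ Mab | inj₁ Mab' = M-fun a b b' Mab Mab'
    ... | inj₁ Mab | inj₂ l'   = ⊥-elim (free a b' l' (b , Mab))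
    ... | inj₂ l   | inj₁ Mab' = ⊥-elim (free a b l (b' , Mab'))
    ... | inj₂ l   | inj₂ l'   = link-functional i j a b b' (adj⇒≢ G Gij) l l'

  maximal⇒covering : ∀ M → IsMaximalMatching G M → Covering M
  maximal⇒covering M (M-matching , M-maximal) i j Gij with matched? M i | matched? M j
  ... | yes i-matched | _             = inj₁ i-matched
  ... | no _          | yes j-matched = inj₂ j-matched
  ... | no i-free     | no j-free     = ⊥-elim (i-free (j , subst (λ N → entry N i j ≡ true)
          (M-maximal (insertEdge M i j) (insertEdge-isMatching {M} i j M-matching Gij i-free j-free)
                     (⊆-insertEdge M i j))
          (insertEdge-here M i j)))

  Saturates : EdgeSet G → List (Fin n × Fin n) → Set
  Saturates M ps = ∀ i j → (i , j) ∈ ps → adj G i j ≡ true → Matched M i ⊎ Matched M j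

  augment : EdgeSet G → Fin n × Fin n → EdgeSet G
  augment M (i , j) with adj G i j Bool.≟ true | matched? M i | matched? M j
  ... | yes _ | no _ | no _ = insertEdge M i j
  ... | _     | _    | _    = M

  augment-spec : ∀ M i j → IsMatching G M → IsMatching G (augment M (i , j)) ×
                 M ⊆ augment M (i , j) × Saturates (augment M (i , j)) [ (i , j) ]
  augment-spec M i j M-matching with adj G i j Bool.≟ true | matched? M i | matched? M j
  ... | yes Gij | no i-free | no j-free =
    insertEdge-isMatching {M} i j M-matching Gij i-free j-free , ⊆-insertEdge M i j ,
    λ { _ _ (here refl) _ → inj₁ (j , insertEdge-here M i j) }
  ... | no ¬Gij | _             | _             =
    M-matching , (λ _ _ e → e) , λ { _ _ (here refl) Gij → ⊥-elim (¬Gij Gij) }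
  ... | yes _   | yes i-matched | _             =
    M-matching , (λ _ _ e → e) , λ { _ _ (here refl) _ → inj₁ i-matched }
  ... | yes _   | no _          | yes j-matched =
    M-matching , (λ _ _ e → e) , λ { _ _ (here refl) _ → inj₂ j-matched }

  augmentAll : EdgeSet G → List (Fin n × Fin n) → EdgeSet G
  augmentAll = foldl augment

  augmentAll-spec : ∀ M ps → IsMatching G M → IsMatching G (augmentAll M ps) ×
                    M ⊆ augmentAll M ps × Saturates (augmentAll M ps) ps
  augmentAll-spec M [] M-matching = M-matching , (λ _ _ e → e) , λ _ _ ()
  augmentAll-spec M ((i , j) ∷ ps) M-matching
    with augment-spec M i j M-matching
  ... | A-matching , M⊆A , A-saturates
    with augmentAll-spec (augment M (i , j)) ps A-matching
  ... | N-matching , A⊆N , N-saturates =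
    N-matching , (λ a b e → A⊆N a b (M⊆A a b e)) , saturates
    where
    A : EdgeSet G
    A = augment M (i , j)
    saturates : Saturates (augmentAll A ps) ((i , j) ∷ ps)
    saturates a b (here refl) Gab with A-saturates a b (here refl) Gab
    ... | inj₁ a-matched = inj₁ (Matched-mono A (augmentAll A ps) A⊆N a-matched)
    ... | inj₂ b-matched = inj₂ (Matched-mono A (augmentAll A ps) A⊆N b-matched)
    saturates a b (there p) = N-saturates a b p

  allPairs : List (Fin n × Fin n)
  allPairs = cartesianProduct (allFin n) (allFin n)

  ∈-allPairs : ∀ i j → (i , j) ∈ allPairs
  ∈-allPairs i j = ∈-cartesianProduct⁺ (∈-allFin i) (∈-allFin j)

  maximalExtension : ∀ M → IsMatching G M → Σ (EdgeSet G) λ N → IsMaximalMatching G N × M ⊆ N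
  maximalExtension M M-matching with augmentAll-spec M allPairs M-matching
  ... | N-matching , M⊆N , N-saturates =
    augmentAll M allPairs ,
    covering⇒maximal (augmentAll M allPairs) N-matching
      (λ i j → N-saturates i j (∈-allPairs i j)) ,
    M⊆N

  ∅ : EdgeSet G
  ∅ = tabulate₂ (λ _ _ → false)

  ∅-free : ∀ i → ¬ Matched ∅ i
  ∅-free i (j , e) = not-¬ e (entry-tabulate₂ (λ _ _ → false) i j)

  ∅-isMatching : IsMatching G ∅
  ∅-isMatching = (λ i j e → ⊥-elim (∅-free i (j , e))) ,
                 (λ i j e → ⊥-elim (∅-free i (j , e))) ,
                 (λ i j _ e → ⊥-elim (∅-free i (j , e)))

  edge∈maximalMatching : ∀ i j → adj G i j ≡ true →
                         Σ (EdgeSet G) λ M → IsMaximalMatching G M × entry M i j ≡ true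
  edge∈maximalMatching i j Gij
    with maximalExtension (insertEdge ∅ i j)
           (insertEdge-isMatching {∅} i j ∅-isMatching Gij (∅-free i) (∅-free j))
  ... | M , M-maximal , ij⊆M = M , M-maximal , ij⊆M i j (insertEdge-here ∅ i j)

-- Counting

injective-missing⇒< : ∀ {m k} {f : Fin m → Fin k} → Injective _≡_ _≡_ f →
                      (x : Fin k) → (∀ a → f a ≢ x) → m < k
injective-missing⇒< {k = suc k} {f} f-injective x x∉f =
  s≤s (injective⇒≤ {f = λ a → punchOut (≢-sym (x∉f a))}
        (λ {a} {b} e → f-injective (punchOut-injective (≢-sym (x∉f a)) (≢-sym (x∉f b)) e)))

record Subfamily {k} (p : Fin k → Bool) : Set where
  field
    size      : ℕ
    embed     : Fin size → Fin k
    injective : Injective _≡_ _≡_ embed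
    sound     : ∀ a → p (embed a) ≡ true
    complete  : ∀ x → p x ≡ true → ∃ λ a → embed a ≡ x

  size< : ∀ x → p x ≡ false → size < k
  size< x px = injective-missing⇒< injective x λ a e → not-¬ (sound a) (trans (cong p e) px)

subfamily : ∀ {k} (p : Fin k → Bool) → Subfamily p
subfamily {zero} p = record
  { size = 0 ; embed = λ () ; injective = λ {} ; sound = λ () ; complete = λ () }
subfamily {suc k} p with subfamily (p ∘ suc) | p zero in p₀
... | S | true = record
  { size = suc S.size ; embed = embed ; injective = injective ; sound = sound ; complete = complete }
  where
  module S = Subfamily S
  embed : Fin (suc S.size) → Fin (suc k)
  embed zero    = zero
  embed (suc a) = suc (S.embed a)
  injective : Injective _≡_ _≡_ embed
  injective {zero}  {zero}  _ = refl
  injective {suc a} {suc b} e = cong suc (S.injective (suc-injective e))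
  sound : ∀ a → p (embed a) ≡ true
  sound zero    = p₀
  sound (suc a) = S.sound a
  complete : ∀ x → p x ≡ true → ∃ λ a → embed a ≡ x
  complete zero    _  = zero , refl
  complete (suc x) px with S.complete x px
  ... | a , refl = suc a , refl
... | S | false = record
  { size = S.size ; embed = suc ∘ S.embed ; injective = S.injective ∘ suc-injective
  ; sound = S.sound ; complete = complete }
  where
  module S = Subfamily S
  complete : ∀ x → p x ≡ true → ∃ λ a → suc (S.embed a) ≡ x
  complete zero    p₀' = ⊥-elim (not-¬ p₀' p₀)
  complete (suc x) px with S.complete x px
  ... | a , refl = a , refl

record MaximalMatchingCorrespondence {n} (G H : Graph n) (p : EdgeSet G → Bool) : Set where
  field
    to           : EdgeSet G → EdgeSet H
    from         : EdgeSet H → EdgeSet G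
    to-maximal   : ∀ M → IsMaximalMatching G M → p M ≡ true → IsMaximalMatching H (to M)
    from-to      : ∀ M → IsMaximalMatching G M → p M ≡ true → from (to M) ≡ M
    from-maximal : ∀ N → IsMaximalMatching H N → IsMaximalMatching G (from N)
    from-p       : ∀ N → IsMaximalMatching H N → p (from N) ≡ true
    to-from      : ∀ N → IsMaximalMatching H N → to (from N) ≡ N

Ψ-decreases : ∀ {n} {G H : Graph n} {p k} → Ψ≡ G k → MaximalMatchingCorrespondence G H p →
              (M₀ : EdgeSet G) → IsMaximalMatching G M₀ → p M₀ ≡ false →
              Σ ℕ λ k' → Ψ≡ H k' × k' < k
Ψ-decreases {H = H} {p} (f , f-injective , f-maximal , f-onto) C M₀ M₀-maximal pM₀
  with f-onto M₀ M₀-maximal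
... | a₀ , refl = S.size , (g , g-injective , g-maximal , g-onto) , S.size< a₀ pM₀
  where
  open MaximalMatchingCorrespondence C
  module S = Subfamily (subfamily (p ∘ f))
  g : Fin S.size → EdgeSet H
  g = to ∘ f ∘ S.embed
  from-g : ∀ a → from (g a) ≡ f (S.embed a)
  from-g a = from-to (f (S.embed a)) (f-maximal (S.embed a)) (S.sound a)
  g-injective : ∀ a b → g a ≡ g b → a ≡ b
  g-injective a b e = S.injective (f-injective (S.embed a) (S.embed b)
    (trans (sym (from-g a)) (trans (cong from e) (from-g b))))
  g-maximal : ∀ a → IsMaximalMatching H (g a)
  g-maximal a = to-maximal (f (S.embed a)) (f-maximal (S.embed a)) (S.sound a)
  g-onto : ∀ N → IsMaximalMatching H N → ∃ λ a → g a ≡ N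
  g-onto N N-maximal with f-onto (from N) (from-maximal N N-maximal)
  ... | x , fx≡fromN with S.complete x (trans (cong p fx≡fromN) (from-p N N-maximal))
  ...   | a , refl = a , trans (cong to fx≡fromN) (to-from N N-maximal)

-- Cycles, leaves and trees

module Cycles {n} (G : Graph n) where

  chain-++⁻ : ∀ xs {y} zs → Chain G (xs ++ y ∷ zs) → Chain G (xs ++ [ y ]) × Chain G (y ∷ zs)
  chain-++⁻ []           zs ch       = tt , ch
  chain-++⁻ (x ∷ [])     zs (e , ch) = (e , tt) , ch
  chain-++⁻ (x ∷ x' ∷ xs) zs (e , ch) with chain-++⁻ (x' ∷ xs) zs ch
  ... | left , right = (e , left) , right

  chain-++⁺ : ∀ xs {y} zs → Chain G (xs ++ [ y ]) → Chain G (y ∷ zs) → Chain G (xs ++ y ∷ zs)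
  chain-++⁺ []            zs _          right = right
  chain-++⁺ (x ∷ [])      zs (e , _)    right = e , right
  chain-++⁺ (x ∷ x' ∷ xs) zs (e , left) right = e , chain-++⁺ (x' ∷ xs) zs left right

  CycleAt : Fin n → List (Fin n) → Set
  CycleAt u xs = (2 ≤ length xs) × Unique (u ∷ xs) × Chain G (u ∷ xs ++ [ u ])

  rotate : ∀ {u xs v} → CycleAt u xs → v ∈ xs → ∃ λ xs' → CycleAt v xs'
  rotate {u} {xs} {v} (long , unique , closed) v∈xs with ∈-∃++ v∈xs
  ... | ys , zs , refl = zs ++ u ∷ ys , long' , unique' , closed'
    where
    swapped : (u ∷ ys) ++ (v ∷ zs) ↭ (v ∷ zs) ++ (u ∷ ys)
    swapped = ↭-++-comm (u ∷ ys) (v ∷ zs)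
    long' : 2 ≤ length (zs ++ u ∷ ys)
    long' = subst (2 ≤_) (cong pred (↭-length swapped)) long
    unique' : Unique (v ∷ zs ++ u ∷ ys)
    unique' = Unique-resp-↭ (setoid (Fin n)) (↭⇒↭ₛ swapped) unique
    halves : Chain G (u ∷ ys ++ [ v ]) × Chain G (v ∷ zs ++ [ u ])
    halves = chain-++⁻ (u ∷ ys) (zs ++ [ u ])
      (subst (Chain G) (cong (u ∷_) (++-assoc ys (v ∷ zs) [ u ])) closed)
    closed' : Chain G (v ∷ (zs ++ u ∷ ys) ++ [ v ])
    closed' = subst (Chain G) (sym (cong (v ∷_) (++-assoc zs (u ∷ ys) [ v ])))
      (chain-++⁺ (v ∷ zs) (ys ++ [ v ]) (proj₂ halves) (proj₁ halves))

  base-neighbours : ∀ {u xs} → CycleAt u xs →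
    Σ (Fin n) λ p → Σ (Fin n) λ s → p ≢ s × adj G p u ≡ true × adj G u s ≡ true
  base-neighbours {u} {xs} (long , unique , closed) with initLast xs | long
  ... | []                | ()
  ... | [] ∷ʳ′ _          | s≤s ()
  ... | (s ∷ mid) ∷ʳ′ p   | _ = p , s , ≢-sym s≢p , proj₁ (proj₂ last) , proj₁ closed
    where
    s≢p : s ≢ p
    s≢p = All.lookup (AllPairs.head (AllPairs.tail unique)) (∈-++⁺ʳ mid (here refl))
    last : Chain G (u ∷ s ∷ mid ++ [ p ]) × Chain G (p ∷ [ u ])
    last = chain-++⁻ (u ∷ s ∷ mid) [ u ]
      (subst (Chain G) (cong (λ t → u ∷ s ∷ t) (++-assoc mid [ p ] [ u ])) closed)

  pendant∉cycle : ∀ {v w} → OnlyNeighbour G w v → ∀ {u xs} → CycleAt u xs → v ∉ u ∷ xs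
  pendant∉cycle {v} only C (here refl) with base-neighbours C
  ... | p , s , p≢s , Gpv , Gvs = p≢s (trans (only p (trans (adj-sym G v p) Gpv)) (sym (only s Gvs)))
  pendant∉cycle only C (there v∈xs) with rotate C v∈xs
  ... | _ , C' = pendant∉cycle only C' (here refl)

≤-sum-map : ∀ {A : Set} (g : A → ℕ) {x xs} → x ∈ xs → g x ≤ sum (map g xs)
≤-sum-map g (here refl)                 = m≤m+n _ _
≤-sum-map g {xs = y ∷ _} (there x∈xs)   = ≤-trans (≤-sum-map g x∈xs) (m≤n+m _ (g y))

+-≤-sum-map : ∀ {A : Set} (g : A → ℕ) {x y xs} → x ∈ xs → y ∈ xs → x ≢ y →
              g x + g y ≤ sum (map g xs)
+-≤-sum-map g (here refl) (here refl) x≢y = ⊥-elim (x≢y refl)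
+-≤-sum-map g {x} (here refl) (there y∈xs) _ = +-monoʳ-≤ (g x) (≤-sum-map g y∈xs)
+-≤-sum-map g {x} {y} (there x∈xs) (here refl) _ =
  ≤-trans (≤-reflexive (+-comm (g x) (g y))) (+-monoʳ-≤ (g y) (≤-sum-map g x∈xs))
+-≤-sum-map g {xs = z ∷ _} (there x∈xs) (there y∈xs) x≢y =
  ≤-trans (+-≤-sum-map g x∈xs y∈xs x≢y) (m≤n+m _ (g z))

degree≡1⇒onlyNeighbour : ∀ {n} (G : Graph n) {c l} → degree G l ≡ 1 → adj G c l ≡ true →
                         OnlyNeighbour G c l
degree≡1⇒onlyNeighbour {n} G {c} {l} deg Gcl j Glj with j ≟ c
... | yes j≡c = j≡c
... | no j≢c  = ⊥-elim (2≰1 (subst (2 ≤_) deg 2≤deg))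
  where
  indicator : Fin n → ℕ
  indicator x = if adj G l x then 1 else 0
  2≤deg : 2 ≤ degree G l
  2≤deg = subst (_≤ degree G l)
    (cong₂ _+_ (cong (if_then 1 else 0) Glj) (cong (if_then 1 else 0) (trans (adj-sym G l c) Gcl)))
    (+-≤-sum-map indicator (∈-allFin j) (∈-allFin c) j≢c)
  2≰1 : ¬ 2 ≤ 1
  2≰1 (s≤s ())

_++ʷ_ : ∀ {n} {G : Graph n} {u v x} → Walk G u v → Walk G v x → Walk G u x
here     ++ʷ q = q
step e p ++ʷ q = step e (p ++ʷ q)

reattach : ∀ {n} (G : Graph n) (l w : Fin n) → l ≢ w → Graph n
reattach G l w l≢w = record
  { adj    = setRow l (_== w) (adj G)
  ; sym    = λ i j → ≡-from-true⇔true (symmetric i j) (symmetric j i)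
  ; irrefl = irreflexive
  }
  where
  symmetric : SymmetricRel (setRow l (_== w) (adj G))
  symmetric = setRow-symmetric l (_== w) (adj G) (λ i j e → trans (adj-sym G j i) e)
  irreflexive : ∀ i → setRow l (_== w) (adj G) i i ≡ false
  irreflexive i with position l i i
  ... | inRow _     = trans (setRow-row l (_== w) (adj G) l) (==-≢ l≢w)
  ... | inCol i≢l   = ⊥-elim (i≢l refl)
  ... | off i≢l _   = trans (setRow-off l (_== w) (adj G) i≢l i≢l) (irrefl G i)

module Reattach {n} (G : Graph n) (l w : Fin n) (l≢w : l ≢ w) where

  G' : Graph n
  G' = reattach G l w l≢w

  adj'-row : ∀ j → adj G' l j ≡ (j == w)
  adj'-row = setRow-row l (_== w) (adj G)

  adj'-col : ∀ {i} → i ≢ l → adj G' i l ≡ (i == w)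
  adj'-col = setRow-col l (_== w) (adj G)

  adj'-off : ∀ {i j} → i ≢ l → j ≢ l → adj G' i j ≡ adj G i j
  adj'-off = setRow-off l (_== w) (adj G)

  adj'-lw : adj G' l w ≡ true
  adj'-lw = trans (adj'-row w) (==-refl w)

  onlyNeighbour' : OnlyNeighbour G' w l
  onlyNeighbour' j e = ==⇒≡ (trans (sym (adj'-row j)) e)

  module _ {c} (Gcl : adj G c l ≡ true) (only : OnlyNeighbour G c l) (Gwc : adj G w c ≡ true) where

    c≢l : c ≢ l
    c≢l = adj⇒≢ G Gcl

    adj'-wc : adj G' w c ≡ true
    adj'-wc = trans (adj'-off (≢-sym l≢w) c≢l) Gwc

    l⇝c : Walk G' l c
    l⇝c = step adj'-lw (step adj'-wc here)

    c⇝l : Walk G' c l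
    c⇝l = step (trans (adj-sym G' c w) adj'-wc) (step (trans (adj-sym G' w l) adj'-lw) here)

    edge⇝ : ∀ a b → adj G a b ≡ true → Walk G' a b
    edge⇝ a b Gab with position l a b
    ... | inRow b     rewrite only b Gab = l⇝c
    ... | inCol a≢l   rewrite only a (trans (adj-sym G l a) Gab) = c⇝l
    ... | off a≢l b≢l = step (trans (adj'-off a≢l b≢l) Gab) here

    walk⇝ : ∀ {u v} → Walk G u v → Walk G' u v
    walk⇝ here = here
    walk⇝ (step {u} {x} e p) = edge⇝ u x e ++ʷ walk⇝ p

    chain-avoiding-l : ∀ xs → All (l ≢_) xs → Chain G' xs → Chain G xs
    chain-avoiding-l []           _                   _        = tt
    chain-avoiding-l (x ∷ [])     _                   _        = tt
    chain-avoiding-l (x ∷ y ∷ xs) (l≢x ∷ l≢y ∷ l∉xs) (e , ch) =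
      trans (sym (adj'-off (≢-sym l≢x) (≢-sym l≢y))) e ,
      chain-avoiding-l (y ∷ xs) (l≢y ∷ l∉xs) ch

    reattach-isTree : IsTree G → IsTree G'
    reattach-isTree (connected , acyclic) = (λ u v → walk⇝ (connected u v)) , acyclic'
      where
      acyclic' : Acyclic G'
      acyclic' (u , xs , C@(long , unique , closed)) = acyclic (u , xs , long , unique ,
        chain-avoiding-l (u ∷ xs ++ [ u ]) (++⁺ l∉cycle (All.head l∉cycle ∷ [])) closed)
        where
        l∉cycle : All (l ≢_) (u ∷ xs)
        l∉cycle = ¬Any⇒All¬ (u ∷ xs) (Cycles.pendant∉cycle G' onlyNeighbour' C)

-- Moving a leaf

record LeafTriple {n} (T : Graph n) : Set where
  field
    {c l₁ l₂ l₃}     : Fin n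
    Tcl₁            : adj T c l₁ ≡ true
    Tcl₂            : adj T c l₂ ≡ true
    Tcl₃            : adj T c l₃ ≡ true
    only₁           : OnlyNeighbour T c l₁
    only₂           : OnlyNeighbour T c l₂
    only₃           : OnlyNeighbour T c l₃
    l₁≢l₂           : l₁ ≢ l₂
    l₁≢l₃           : l₁ ≢ l₃
    l₂≢l₃           : l₂ ≢ l₃

pendantStar⇒leafTriple : ∀ {n} (T : Graph n) {d} → 4 ≤ d → HasPendantStar T d → LeafTriple T
pendantStar⇒leafTriple T (s≤s (s≤s (s≤s (s≤s _))))
  (c , _ , l₁ ∷ l₂ ∷ l₃ ∷ _ , _ , (l₁≢l₂ ∷ l₁≢l₃ ∷ _) ∷ (l₂≢l₃ ∷ _) ∷ _ ,
   (Tcl₁ , deg₁) ∷ (Tcl₂ , deg₂) ∷ (Tcl₃ , deg₃) ∷ _) = record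
  { Tcl₁ = Tcl₁ ; Tcl₂ = Tcl₂ ; Tcl₃ = Tcl₃
  ; only₁ = degree≡1⇒onlyNeighbour T deg₁ Tcl₁
  ; only₂ = degree≡1⇒onlyNeighbour T deg₂ Tcl₂
  ; only₃ = degree≡1⇒onlyNeighbour T deg₃ Tcl₃
  ; l₁≢l₂ = l₁≢l₂ ; l₁≢l₃ = l₁≢l₃ ; l₂≢l₃ = l₂≢l₃
  }

module LeafMove {n} (T : Graph n) (L : LeafTriple T) where

  open LeafTriple L
  open Reattach T l₁ l₂ l₁≢l₂ public
  open Matching using (Covering; covering⇒maximal; maximal⇒covering)

  c≢l₁ : c ≢ l₁
  c≢l₁ = adj⇒≢ T Tcl₁

  c≢l₂ : c ≢ l₂
  c≢l₂ = adj⇒≢ T Tcl₂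

  l₂-neighbours' : ∀ x → adj G' l₂ x ≡ true → x ≡ c ⊎ x ≡ l₁
  l₂-neighbours' x e with position l₁ l₂ x
  ... | inRow _       = ⊥-elim (l₁≢l₂ refl)
  ... | inCol _       = inj₂ refl
  ... | off l₂≢l₁ x≢l₁ = inj₁ (only₂ x (trans (sym (adj'-off l₂≢l₁ x≢l₁)) e))

  only₃' : OnlyNeighbour G' c l₃
  only₃' x e with position l₁ l₃ x
  ... | inRow _        = ⊥-elim (l₁≢l₃ refl)
  ... | inCol l₃≢l₁    = ⊥-elim (not-¬ (trans (sym (adj'-col l₃≢l₁)) e) (==-≢ (≢-sym l₂≢l₃)))
  ... | off l₃≢l₁ x≢l₁ = only₃ x (trans (sym (adj'-off l₃≢l₁ x≢l₁)) e)

  detach : EdgeSet T → EdgeSet T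
  detach = setRowᴱ l₁ (λ _ → false)

  -- l₁ is matched to its only neighbour l₂ in T' exactly when l₂ is not matched to c.
  partner : EdgeSet T → Fin n → Bool
  partner M x = not (entry M c l₂) ∧ (x == l₂)

  partner⁻ : ∀ M x → partner M x ≡ true → entry M c l₂ ≡ false × x ≡ l₂
  partner⁻ M x e with ∧-true⁻ (not (entry M c l₂)) e
  ... | free , x==l₂ = not-injective free , ==⇒≡ x==l₂

  reroute : EdgeSet T → EdgeSet T
  reroute M = setRowᴱ l₁ (partner M) M

  module FromT (M : EdgeSet T) (M-maximal : IsMaximalMatching T M)
               (cl₁∉M : entry M c l₁ ≡ false) where

    M-edge : ∀ i j → entry M i j ≡ true → adj T i j ≡ true
    M-edge = proj₁ (proj₁ M-maximal)

    M-sym : SymmetricRel (entry M)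
    M-sym = proj₁ (proj₂ (proj₁ M-maximal))

    M-fun : FunctionalRel (entry M)
    M-fun = proj₂ (proj₂ (proj₁ M-maximal))

    row-l₁-empty : ∀ j → entry M l₁ j ≡ false
    row-l₁-empty j with entry M l₁ j in Ml₁j
    ... | false = refl
    ... | true with only₁ j (M-edge l₁ j Ml₁j)
    ...   | refl = ⊥-elim (not-¬ (M-sym l₁ c Ml₁j) cl₁∉M)

    avoids-l₁ : ∀ {i j} → entry M i j ≡ true → j ≢ l₁
    avoids-l₁ {i} Mij refl = not-¬ (M-sym i l₁ Mij) (row-l₁-empty i)

    reroute-isMatching : IsMatching G' (reroute M)
    reroute-isMatching = setRowᴱ-isMatching l₁ (partner M) G' M M-sym M-fun
      (λ i≢l₁ j≢l₁ Mij → trans (adj'-off i≢l₁ j≢l₁) (M-edge _ _ Mij))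
      (λ x e → trans (adj'-row x) (trans (cong (_== l₂) (proj₂ (partner⁻ M x e))) (==-refl l₂)))
      (λ x y ex ey → trans (proj₂ (partner⁻ M x ex)) (sym (proj₂ (partner⁻ M y ey))))
      row-free
      where
      row-free : ∀ x j → partner M x ≡ true → entry M x j ≡ true → j ≡ l₁
      row-free x j e Mxj with partner⁻ M x e
      ... | cl₂∉M , refl with only₂ j (M-edge l₂ j Mxj)
      ...   | refl = ⊥-elim (not-¬ (M-sym l₂ c Mxj) cl₂∉M)

    l₁l₂-covered : Matched (reroute M) l₁ ⊎ Matched (reroute M) l₂
    l₁l₂-covered with true-or-false (entry M c l₂)
    ... | inj₁ Mcl₂ =
      inj₂ (c , trans (setRowᴱ-off l₁ (partner M) M (≢-sym l₁≢l₂) c≢l₁) (M-sym c l₂ Mcl₂))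
    ... | inj₂ Mcl₂ = inj₁ (l₂ , trans (setRowᴱ-row l₁ (partner M) M l₂)
                               (trans (cong (λ b → not b ∧ (l₂ == l₂)) Mcl₂) (==-refl l₂)))

    matched-reroute : ∀ {i} → i ≢ l₁ → Matched M i → Matched (reroute M) i
    matched-reroute i≢l₁ (x , Mix) =
      x , trans (setRowᴱ-off l₁ (partner M) M i≢l₁ (avoids-l₁ Mix)) Mix

    reroute-covering : Covering G' (reroute M)
    reroute-covering i j e with position l₁ i j
    ... | inRow j rewrite onlyNeighbour' j e = l₁l₂-covered
    ... | inCol i≢l₁ rewrite onlyNeighbour' i (trans (adj-sym G' l₁ i) e) = swap l₁l₂-covered
    ... | off i≢l₁ j≢l₁
      with maximal⇒covering T M M-maximal i j (trans (sym (adj'-off i≢l₁ j≢l₁)) e)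
    ...   | inj₁ i-matched = inj₁ (matched-reroute i≢l₁ i-matched)
    ...   | inj₂ j-matched = inj₂ (matched-reroute j≢l₁ j-matched)

    reroute-maximal : IsMaximalMatching G' (reroute M)
    reroute-maximal = covering⇒maximal G' (reroute M) reroute-isMatching reroute-covering

    detach-reroute : detach (reroute M) ≡ M
    detach-reroute = setRowᴱ-≡ l₁ (λ _ → false) (reroute M) M M-sym (λ j → sym (row-l₁-empty j))
      (setRowᴱ-off l₁ (partner M) M)

  module FromT' (N : EdgeSet G') (N-maximal : IsMaximalMatching G' N) where

    N-edge : ∀ i j → entry N i j ≡ true → adj G' i j ≡ true
    N-edge = proj₁ (proj₁ N-maximal)

    N-sym : SymmetricRel (entry N)
    N-sym = proj₁ (proj₂ (proj₁ N-maximal))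

    N-fun : FunctionalRel (entry N)
    N-fun = proj₂ (proj₂ (proj₁ N-maximal))

    N-covering : Covering G' N
    N-covering = maximal⇒covering G' N N-maximal

    l₁-partner : ∀ {j} → entry N l₁ j ≡ true → j ≡ l₂
    l₁-partner {j} Nl₁j = onlyNeighbour' j (N-edge l₁ j Nl₁j)

    -- This is where the third leaf is needed.
    c-matched : Matched N c
    c-matched with N-covering c l₃ (trans (adj'-off c≢l₁ (≢-sym l₁≢l₃)) Tcl₃)
    ... | inj₁ c-matched = c-matched
    ... | inj₂ (x , Nl₃x) with only₃' x (N-edge l₃ x Nl₃x)
    ...   | refl = l₃ , N-sym l₃ c Nl₃x

    matched-detach : ∀ {i} → i ≢ l₁ → Matched N i → Matched (detach N) i ⊎ i ≡ l₂
    matched-detach {i} i≢l₁ (x , Nix) with position l₁ i x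
    ... | inRow _       = ⊥-elim (i≢l₁ refl)
    ... | inCol _       = inj₂ (l₁-partner (N-sym i l₁ Nix))
    ... | off _ x≢l₁    = inj₁ (x , trans (setRowᴱ-off l₁ (λ _ → false) N i≢l₁ x≢l₁) Nix)

    c-matched-detach : Matched (detach N) c
    c-matched-detach with matched-detach c≢l₁ c-matched
    ... | inj₁ matched = matched
    ... | inj₂ c≡l₂    = ⊥-elim (c≢l₂ c≡l₂)

    detach-isMatching : IsMatching T (detach N)
    detach-isMatching = setRowᴱ-isMatching l₁ (λ _ → false) T N N-sym N-fun
      (λ i≢l₁ j≢l₁ Nij → trans (sym (adj'-off i≢l₁ j≢l₁)) (N-edge _ _ Nij))
      (λ _ ()) (λ _ _ ()) (λ _ _ ())

    covered-via : ∀ {i j} → adj T i j ≡ true → i ≢ l₁ → Matched N i →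
                  Matched (detach N) i ⊎ Matched (detach N) j
    covered-via {i} {j} Tij i≢l₁ i-matched with matched-detach i≢l₁ i-matched
    ... | inj₁ matched = inj₁ matched
    ... | inj₂ refl rewrite only₂ j Tij = inj₂ c-matched-detach

    detach-covering : Covering T (detach N)
    detach-covering i j Tij with position l₁ i j
    ... | inRow j rewrite only₁ j Tij = inj₂ c-matched-detach
    ... | inCol i≢l₁ rewrite only₁ i (trans (adj-sym T l₁ i) Tij) = inj₁ c-matched-detach
    ... | off i≢l₁ j≢l₁ with N-covering i j (trans (adj'-off i≢l₁ j≢l₁) Tij)
    ...   | inj₁ i-matched = covered-via Tij i≢l₁ i-matched
    ...   | inj₂ j-matched = swap (covered-via (trans (adj-sym T j i) Tij) j≢l₁ j-matched)

    detach-maximal : IsMaximalMatching T (detach N)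
    detach-maximal = covering⇒maximal T (detach N) detach-isMatching detach-covering

    detach-avoids-cl₁ : not (entry (detach N) c l₁) ≡ true
    detach-avoids-cl₁ = cong not (setRowᴱ-col l₁ (λ _ → false) N c≢l₁)

    detach-cl₂ : entry (detach N) c l₂ ≡ entry N c l₂
    detach-cl₂ = setRowᴱ-off l₁ (λ _ → false) N c≢l₁ (≢-sym l₁≢l₂)

    l₁l₂∈N : entry N c l₂ ≡ false → entry N l₁ l₂ ≡ true
    l₁l₂∈N cl₂∉N with N-covering l₁ l₂ adj'-lw
    ... | inj₁ (x , Nl₁x) = subst (λ y → entry N l₁ y ≡ true) (l₁-partner Nl₁x) Nl₁x
    ... | inj₂ (x , Nl₂x) with l₂-neighbours' x (N-edge l₂ x Nl₂x)
    ...   | inj₁ refl = ⊥-elim (not-¬ (N-sym l₂ c Nl₂x) cl₂∉N)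
    ...   | inj₂ refl = N-sym l₂ l₁ Nl₂x

    l₁l₂∈N⇒cl₂∉N : entry N l₁ l₂ ≡ true → entry N c l₂ ≡ false
    l₁l₂∈N⇒cl₂∉N Nl₁l₂ with true-or-false (entry N c l₂)
    ... | inj₁ Ncl₂ = ⊥-elim (c≢l₁ (N-fun l₂ c l₁ (N-sym c l₂ Ncl₂) (N-sym l₁ l₂ Nl₁l₂)))
    ... | inj₂ cl₂∉N = cl₂∉N

    partner-detach : ∀ j → partner (detach N) j ≡ entry N l₁ j
    partner-detach j = ≡-from-true⇔true to from
      where
      to : partner (detach N) j ≡ true → entry N l₁ j ≡ true
      to e with partner⁻ (detach N) j e
      ... | cl₂∉detach , refl = l₁l₂∈N (trans (sym detach-cl₂) cl₂∉detach)
      from : entry N l₁ j ≡ true → partner (detach N) j ≡ true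
      from Nl₁j with l₁-partner Nl₁j
      ... | refl = cong₂ (λ b e → not b ∧ e) (trans detach-cl₂ (l₁l₂∈N⇒cl₂∉N Nl₁j)) (==-refl l₂)

    reroute-detach : reroute (detach N) ≡ N
    reroute-detach = setRowᴱ-≡ l₁ (partner (detach N)) (detach N) N N-sym partner-detach
      (setRowᴱ-off l₁ (λ _ → false) N)

  correspondence : MaximalMatchingCorrespondence T G' (λ M → not (entry M c l₁))
  correspondence = record
    { to           = reroute
    ; from         = detach
    ; to-maximal   = λ M M-maximal cl₁∉M → FromT.reroute-maximal M M-maximal (not-injective cl₁∉M)
    ; from-to      = λ M M-maximal cl₁∉M → FromT.detach-reroute M M-maximal (not-injective cl₁∉M)
    ; from-maximal = FromT'.detach-maximal
    ; from-p       = FromT'.detach-avoids-cl₁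
    ; to-from      = FromT'.reroute-detach
    }

  Ψ-reattach< : ∀ {k} → Ψ≡ T k → Σ ℕ λ k' → Ψ≡ G' k' × k' < k
  Ψ-reattach< ψ with Matching.edge∈maximalMatching T c l₁ Tcl₁
  ... | M₀ , M₀-maximal , cl₁∈M₀ = Ψ-decreases ψ correspondence M₀ M₀-maximal (cong not cl₁∈M₀)

  reattached-isTree : IsTree T → IsTree G'
  reattached-isTree = reattach-isTree Tcl₁ only₁ (trans (adj-sym T l₂ c) Tcl₂)

corollary3p9 : (n : ℕ) → 8 ≤ n → (T : Graph n) → IsTree T → ¬ IsStar T →
               (d : ℕ) → 4 ≤ d → HasPendantStar T d →
               (k : ℕ) → Ψ≡ T k →
               Σ (Graph n) λ T' → IsTree T' × Σ ℕ λ k' → Ψ≡ T' k' × (k' < k)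
corollary3p9 n _ T T-tree _ d 4≤d star k ψ = G' , reattached-isTree T-tree , Ψ-reattach< ψ
  where open LeafMove T (pendantStar⇒leafTriple T 4≤d star)
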